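{- In System $\mathsf{F}_\wedge$, if $\Theta\vdash t:\forall X.T[X\wedge S/X^-]$ and $\Theta\vdash S'<:S$, then $\Theta\vdash t\{S'\}:T[S'/X]$.
   Context: System $\mathsf{F}_\wedge$. Types: $T ::= \top\mid X\mid T\to T\mid\forall X.T\mid T\wedge T$ (up to $\alpha$-conversion). Contexts are finite sequences of assumptions $X<:T$ and $x:T$ with the usual well-formedness judgment. Subtyping $\Theta\vdash S<:T$ is generated by: (Var) $\Theta,X<:T,\Theta'\vdash X<:T$; (Top) $\Theta\vdash T<:\top$; (Refl); (Trans); ($\to$) from $\Theta\vdash S'<:S$, $\Theta\vdash T<:T'$ infer $\Theta\vdash S\to T<:S'\to T'$; ($\forall$) from $\Theta,X<:\top\vdash S<:T$ infer $\Theta\vdash\forall X.S<:\forall X.T$; $S\wedge S'<:S$; $S\wedge S'<:S'$; $T<:S\wedge S'$ from $T<:S$ and $T<:S'$. Terms: $t ::= \mathsf{top}\mid x\mid\lambda(x:T).t\mid\Lambda X.t\mid t\,t\mid t\{T\}$. Typing $\Theta\vdash t:T$: $\Theta\vdash\mathsf{top}:\top$; $\Theta,x:T,\Theta'\vdash x:T$; subsumption (from $t:T$ and $T<:T'$ infer $t:T'$); $\lambda$-introduction; application; from $\Theta,X<:\top\vdash t:T$ infer $\Theta\vdash\Lambda X.t:\forall X.T$; from $\Theta\vdash t:\forall X.T$ and $\Theta\vdash S'$ infer $\Theta\vdash t\{S'\}:T[S'/X]$ (capture-avoiding substitution). Mixed substitution $T[(S_-,S_+)/X]$: $X[(S_-,S_+)/X]=S_+$;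 $Y[(S_-,S_+)/X]=Y$ for $Y\not\equiv X$; $\top[(S_-,S_+)/X]=\top$; $(T\to T')[(S_-,S_+)/X]=T[(S_+,S_-)/X]\to T'[(S_-,S_+)/X]$; $(\forall Y.T)[(S_-,S_+)/X]=\forall Y.T[(S_-,S_+)/X]$; $(T\wedge T')[(S_-,S_+)/X]=T[(S_-,S_+)/X]\wedge T'[(S_-,S_+)/X]$. $T[R/X^-]$ abbreviates $T[(R,X)/X]$. -}

module Defs where

-- System F∧ with de Bruijn indices.
-- Type variables and term variables are counted separately.

open import Data.Nat using (ℕ; zero; suc; _<_)
open import Data.List using (List; []; _∷_)
open import Data.Maybe using (Maybe; just; nothing)
import Data.Maybe as Maybe
open import Relation.Binary.PropositionalEquality using (_≡_)

infixr 7 _⇒_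
infixr 8 _∧_

data Ty : Set where
  ⊤'   : Ty
  var  : ℕ → Ty
  _⇒_  : Ty → Ty → Ty
  all  : Ty → Ty          -- ∀X.T, X is index 0 in the body
  _∧_  : Ty → Ty → Ty

data Tm : Set where
  top  : Tm
  var  : ℕ → Tm
  lam  : Ty → Tm → Tm     -- λ(x:T).t, x is term index 0 in the body
  Lam  : Tm → Tm          -- ΛX.t, X is type index 0 in the body
  app  : Tm → Tm → Tm
  tapp : Tm → Ty → Tm

ext : (ℕ → ℕ) → ℕ → ℕ
ext ρ zero    = zero
ext ρ (suc n) = suc (ρ n)

rename : (ℕ → ℕ) → Ty → Ty
rename ρ ⊤'       = ⊤'
rename ρ (var n)  = var (ρ n)
rename ρ (A ⇒ B)  = rename ρ A ⇒ rename ρ B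
rename ρ (all A)  = all (rename (ext ρ) A)
rename ρ (A ∧ B)  = rename ρ A ∧ rename ρ B

↑ : Ty → Ty
↑ = rename suc

exts : (ℕ → Ty) → ℕ → Ty
exts σ zero    = var zero
exts σ (suc n) = ↑ (σ n)

subst : (ℕ → Ty) → Ty → Ty
subst σ ⊤'       = ⊤'
subst σ (var n)  = σ n
subst σ (A ⇒ B)  = subst σ A ⇒ subst σ B
subst σ (all A)  = all (subst (exts σ) A)
subst σ (A ∧ B)  = subst σ A ∧ subst σ B

single : Ty → ℕ → Ty
single S zero    = S
single S (suc n) = var n

_[_] : Ty → Ty → Ty
T [ S ] = subst (single S) T

-- Mixed substitution: σ₋ used at negative positions, σ₊ at positive ones.
-- (T → T')[(σ₋,σ₊)] = T[(σ₊,σ₋)] → T'[(σ₋,σ₊)]; variables use σ₊.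
msubst : (ℕ → Ty) → (ℕ → Ty) → Ty → Ty
msubst σ₋ σ₊ ⊤'       = ⊤'
msubst σ₋ σ₊ (var n)  = σ₊ n
msubst σ₋ σ₊ (A ⇒ B)  = msubst σ₊ σ₋ A ⇒ msubst σ₋ σ₊ B
msubst σ₋ σ₊ (all A)  = all (msubst (exts σ₋) (exts σ₊) A)
msubst σ₋ σ₊ (A ∧ B)  = msubst σ₋ σ₊ A ∧ msubst σ₋ σ₊ B

-- The substitution replacing variable X = index 0 by R and
-- leaving every other variable (including X's own index) alone.
at0 : Ty → ℕ → Ty
at0 R zero    = R
at0 R (suc n) = var (suc n)

-- T[(S₋,S₊)/X] for X = index 0 (X stays in scope, i.e. S₋, S₊ live in
-- the same scope as T).
_[_,_/0] : Ty → Ty → Ty → Ty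
T [ S₋ , S₊ /0] = msubst (at0 S₋) (at0 S₊) T

-- T[R/X⁻] = T[(R,X)/X]
_[_/0⁻] : Ty → Ty → Ty
T [ R /0⁻] = T [ R , var zero /0]

-- Contexts: head = most recent assumption

data Entry : Set where
  tv : Ty → Entry
  tm : Ty → Entry

Ctx : Set
Ctx = List Entry

ntv : Ctx → ℕ
ntv []          = zero
ntv (tv _ ∷ Θ)  = suc (ntv Θ)
ntv (tm _ ∷ Θ)  = ntv Θ

-- bound of type variable n, expressed in the scope of the whole context
lookupTv : Ctx → ℕ → Maybe Ty
lookupTv []         n       = nothing
lookupTv (tm _ ∷ Θ) n       = lookupTv Θ n
lookupTv (tv T ∷ Θ) zero    = just (↑ T)
lookupTv (tv T ∷ Θ) (suc n) = Maybe.map ↑ (lookupTv Θ n)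

-- type of term variable n, expressed in the scope of the whole context
lookupTm : Ctx → ℕ → Maybe Ty
lookupTm []         n       = nothing
lookupTm (tv _ ∷ Θ) n       = Maybe.map ↑ (lookupTm Θ n)
lookupTm (tm T ∷ Θ) zero    = just T
lookupTm (tm T ∷ Θ) (suc n) = lookupTm Θ n

infix 4 _⊢ty_ ⊢ctx_ _⊢_<:_ _⊢_∶_

data _⊢ty_ (Θ : Ctx) : Ty → Set where
  wf-top : Θ ⊢ty ⊤'
  wf-var : ∀ {n} → n < ntv Θ → Θ ⊢ty var n
  wf-⇒   : ∀ {A B} → Θ ⊢ty A → Θ ⊢ty B → Θ ⊢ty A ⇒ B
  wf-all : ∀ {A} → (tv ⊤' ∷ Θ) ⊢ty A → Θ ⊢ty all A
  wf-∧   : ∀ {A B} → Θ ⊢ty A → Θ ⊢ty B → Θ ⊢ty A ∧ B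

data ⊢ctx_ : Ctx → Set where
  wf-[]  : ⊢ctx []
  wf-tv  : ∀ {Θ T} → ⊢ctx Θ → Θ ⊢ty T → ⊢ctx (tv T ∷ Θ)
  wf-tm  : ∀ {Θ T} → ⊢ctx Θ → Θ ⊢ty T → ⊢ctx (tm T ∷ Θ)

-- Subtyping (judgements presuppose well-formedness, enforced at the axioms)

data _⊢_<:_ (Θ : Ctx) : Ty → Ty → Set where
  s-var   : ∀ {X T} → ⊢ctx Θ → lookupTv Θ X ≡ just T → Θ ⊢ var X <: T
  s-top   : ∀ {T} → ⊢ctx Θ → Θ ⊢ty T → Θ ⊢ T <: ⊤'
  s-refl  : ∀ {T} → ⊢ctx Θ → Θ ⊢ty T → Θ ⊢ T <: T
  s-trans : ∀ {S U T} → Θ ⊢ S <: U → Θ ⊢ U <: T → Θ ⊢ S <: T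
  s-⇒     : ∀ {S S' T T'} → Θ ⊢ S' <: S → Θ ⊢ T <: T' → Θ ⊢ S ⇒ T <: S' ⇒ T'
  s-all   : ∀ {S T} → (tv ⊤' ∷ Θ) ⊢ S <: T → Θ ⊢ all S <: all T
  s-∧l    : ∀ {S S'} → ⊢ctx Θ → Θ ⊢ty S ∧ S' → Θ ⊢ S ∧ S' <: S
  s-∧r    : ∀ {S S'} → ⊢ctx Θ → Θ ⊢ty S ∧ S' → Θ ⊢ S ∧ S' <: S'
  s-∧     : ∀ {T S S'} → Θ ⊢ T <: S → Θ ⊢ T <: S' → Θ ⊢ T <: S ∧ S'

data _⊢_∶_ (Θ : Ctx) : Tm → Ty → Set where
  t-top  : ⊢ctx Θ → Θ ⊢ top ∶ ⊤'
  t-var  : ∀ {x T} → ⊢ctx Θ → lookupTm Θ x ≡ just T → Θ ⊢ var x ∶ T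
  t-sub  : ∀ {t T T'} → Θ ⊢ t ∶ T → Θ ⊢ T <: T' → Θ ⊢ t ∶ T'
  t-lam  : ∀ {t T T'} → (tm T ∷ Θ) ⊢ t ∶ T' → Θ ⊢ lam T t ∶ T ⇒ T'
  t-app  : ∀ {t u T T'} → Θ ⊢ t ∶ T ⇒ T' → Θ ⊢ u ∶ T → Θ ⊢ app t u ∶ T'
  t-Lam  : ∀ {t T} → (tv ⊤' ∷ Θ) ⊢ t ∶ T → Θ ⊢ Lam t ∶ all T
  t-tapp : ∀ {t T S'} → Θ ⊢ t ∶ all T → Θ ⊢ty S' → Θ ⊢ tapp t S' ∶ T [ S' ]

module Submission where

-- Instantiating ∀X.T[X∧S/X⁻] at S' yields the mixed substitution
-- T[(S'∧S, S')/X]. Mixed substitution is covariant in its positive and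
-- contravariant in its negative argument, and S' <: S'∧S because S' <: S;
-- so that type is a subtype of T[(S', S')/X] = T[S'/X].

open import Defs
open import Data.Nat using (ℕ; zero; suc; _<_; z≤n; s≤s; s<s⁻¹)
open import Data.List using ([]; _∷_)
open import Data.Maybe using (just; nothing)
open import Data.Product using (_×_; _,_; proj₁; proj₂)
open import Relation.Binary.PropositionalEquality
  using (_≡_; refl; sym; trans; cong; cong₂) renaming (subst to ≡-subst)

rename-cong : ∀ {ρ ρ'} → (∀ n → ρ n ≡ ρ' n) → ∀ A → rename ρ A ≡ rename ρ' A
rename-cong h ⊤'      = refl
rename-cong h (var n) = cong var (h n)
rename-cong h (A ⇒ B) = cong₂ _⇒_ (rename-cong h A) (rename-cong h B)
rename-cong h (all A) = cong all (rename-cong ext-cong A)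
  where
  ext-cong : ∀ n → ext _ n ≡ ext _ n
  ext-cong zero    = refl
  ext-cong (suc n) = cong suc (h n)
rename-cong h (A ∧ B) = cong₂ _∧_ (rename-cong h A) (rename-cong h B)

rename-∘ : ∀ ρ ρ' A → rename ρ (rename ρ' A) ≡ rename (λ n → ρ (ρ' n)) A
rename-∘ ρ ρ' ⊤'      = refl
rename-∘ ρ ρ' (var n) = refl
rename-∘ ρ ρ' (A ⇒ B) = cong₂ _⇒_ (rename-∘ ρ ρ' A) (rename-∘ ρ ρ' B)
rename-∘ ρ ρ' (all A) = cong all (trans (rename-∘ (ext ρ) (ext ρ') A) (rename-cong ext-∘ A))
  where
  ext-∘ : ∀ n → ext ρ (ext ρ' n) ≡ ext (λ m → ρ (ρ' m)) n
  ext-∘ zero    = refl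
  ext-∘ (suc n) = refl
rename-∘ ρ ρ' (A ∧ B) = cong₂ _∧_ (rename-∘ ρ ρ' A) (rename-∘ ρ ρ' B)

rename-ext-↑ : ∀ ρ A → rename (ext ρ) (↑ A) ≡ ↑ (rename ρ A)
rename-ext-↑ ρ A = trans (rename-∘ (ext ρ) suc A) (sym (rename-∘ suc ρ A))

exts-cong : ∀ {σ σ'} → (∀ n → σ n ≡ σ' n) → ∀ n → exts σ n ≡ exts σ' n
exts-cong h zero    = refl
exts-cong h (suc n) = cong ↑ (h n)

subst-cong : ∀ {σ σ'} → (∀ n → σ n ≡ σ' n) → ∀ A → subst σ A ≡ subst σ' A
subst-cong h ⊤'      = refl
subst-cong h (var n) = h n
subst-cong h (A ⇒ B) = cong₂ _⇒_ (subst-cong h A) (subst-cong h B)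
subst-cong h (all A) = cong all (subst-cong (exts-cong h) A)
subst-cong h (A ∧ B) = cong₂ _∧_ (subst-cong h A) (subst-cong h B)

subst-rename : ∀ σ ρ A → subst σ (rename ρ A) ≡ subst (λ n → σ (ρ n)) A
subst-rename σ ρ ⊤'      = refl
subst-rename σ ρ (var n) = refl
subst-rename σ ρ (A ⇒ B) = cong₂ _⇒_ (subst-rename σ ρ A) (subst-rename σ ρ B)
subst-rename σ ρ (all A) = cong all (trans (subst-rename (exts σ) (ext ρ) A) (subst-cong exts-ext A))
  where
  exts-ext : ∀ n → exts σ (ext ρ n) ≡ exts (λ m → σ (ρ m)) n
  exts-ext zero    = refl
  exts-ext (suc n) = refl
subst-rename σ ρ (A ∧ B) = cong₂ _∧_ (subst-rename σ ρ A) (subst-rename σ ρ B)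

rename-subst : ∀ ρ σ A → rename ρ (subst σ A) ≡ subst (λ n → rename ρ (σ n)) A
rename-subst ρ σ ⊤'      = refl
rename-subst ρ σ (var n) = refl
rename-subst ρ σ (A ⇒ B) = cong₂ _⇒_ (rename-subst ρ σ A) (rename-subst ρ σ B)
rename-subst ρ σ (all A) = cong all (trans (rename-subst (ext ρ) (exts σ) A) (subst-cong ext-exts A))
  where
  ext-exts : ∀ n → rename (ext ρ) (exts σ n) ≡ exts (λ m → rename ρ (σ m)) n
  ext-exts zero    = refl
  ext-exts (suc n) = rename-ext-↑ ρ (σ n)
rename-subst ρ σ (A ∧ B) = cong₂ _∧_ (rename-subst ρ σ A) (rename-subst ρ σ B)

subst-exts-↑ : ∀ σ A → subst (exts σ) (↑ A) ≡ ↑ (subst σ A)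
subst-exts-↑ σ A = trans (subst-rename (exts σ) suc A) (sym (rename-subst suc σ A))

subst-var : ∀ A → subst var A ≡ A
subst-var ⊤'      = refl
subst-var (var n) = refl
subst-var (A ⇒ B) = cong₂ _⇒_ (subst-var A) (subst-var B)
subst-var (all A) = cong all (trans (subst-cong exts-var A) (subst-var A))
  where
  exts-var : ∀ n → exts var n ≡ var n
  exts-var zero    = refl
  exts-var (suc n) = refl
subst-var (A ∧ B) = cong₂ _∧_ (subst-var A) (subst-var B)

↑-[] : ∀ A S → ↑ A [ S ] ≡ A
↑-[] A S = trans (subst-rename (single S) suc A) (subst-var A)

msubst-cong : ∀ {σ₋ σ₊ τ₋ τ₊} → (∀ n → σ₋ n ≡ τ₋ n) → (∀ n → σ₊ n ≡ τ₊ n)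
  → ∀ A → msubst σ₋ σ₊ A ≡ msubst τ₋ τ₊ A
msubst-cong h₋ h₊ ⊤'      = refl
msubst-cong h₋ h₊ (var n) = h₊ n
msubst-cong h₋ h₊ (A ⇒ B) = cong₂ _⇒_ (msubst-cong h₊ h₋ A) (msubst-cong h₋ h₊ B)
msubst-cong h₋ h₊ (all A) = cong all (msubst-cong (exts-cong h₋) (exts-cong h₊) A)
msubst-cong h₋ h₊ (A ∧ B) = cong₂ _∧_ (msubst-cong h₋ h₊ A) (msubst-cong h₋ h₊ B)

subst-msubst : ∀ τ σ₋ σ₊ A
  → subst τ (msubst σ₋ σ₊ A) ≡ msubst (λ n → subst τ (σ₋ n)) (λ n → subst τ (σ₊ n)) A
subst-msubst τ σ₋ σ₊ ⊤'      = refl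
subst-msubst τ σ₋ σ₊ (var n) = refl
subst-msubst τ σ₋ σ₊ (A ⇒ B) = cong₂ _⇒_ (subst-msubst τ σ₊ σ₋ A) (subst-msubst τ σ₋ σ₊ B)
subst-msubst τ σ₋ σ₊ (all A) =
  cong all (trans (subst-msubst (exts τ) (exts σ₋) (exts σ₊) A)
                  (msubst-cong (exts-exts σ₋) (exts-exts σ₊) A))
  where
  exts-exts : ∀ σ n → subst (exts τ) (exts σ n) ≡ exts (λ m → subst τ (σ m)) n
  exts-exts σ zero    = refl
  exts-exts σ (suc n) = subst-exts-↑ τ (σ n)
subst-msubst τ σ₋ σ₊ (A ∧ B) = cong₂ _∧_ (subst-msubst τ σ₋ σ₊ A) (subst-msubst τ σ₋ σ₊ B)

msubst-diagonal : ∀ σ A → msubst σ σ A ≡ subst σ A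
msubst-diagonal σ ⊤'      = refl
msubst-diagonal σ (var n) = refl
msubst-diagonal σ (A ⇒ B) = cong₂ _⇒_ (msubst-diagonal σ A) (msubst-diagonal σ B)
msubst-diagonal σ (all A) = cong all (msubst-diagonal (exts σ) A)
msubst-diagonal σ (A ∧ B) = cong₂ _∧_ (msubst-diagonal σ A) (msubst-diagonal σ B)

[/0]-[] : ∀ T R₋ R₊ S → T [ R₋ , R₊ /0] [ S ] ≡ msubst (single (R₋ [ S ])) (single (R₊ [ S ])) T
[/0]-[] T R₋ R₊ S = trans (subst-msubst (single S) _ _ T) (msubst-cong (at0-[] R₋) (at0-[] R₊) T)
  where
  at0-[] : ∀ R n → at0 R n [ S ] ≡ single (R [ S ]) n
  at0-[] R zero    = refl
  at0-[] R (suc n) = refl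

[∧/0⁻]-[] : ∀ T S S' → T [ var 0 ∧ ↑ S /0⁻] [ S' ] ≡ msubst (single (S' ∧ S)) (single S') T
[∧/0⁻]-[] T S S' =
  trans ([/0]-[] T (var 0 ∧ ↑ S) (var 0) S')
        (cong (λ U → msubst (single (S' ∧ U)) (single S') T) (↑-[] S S'))

⊢ty-resp-ntv : ∀ {Γ Δ A} → ntv Γ ≡ ntv Δ → Γ ⊢ty A → Δ ⊢ty A
⊢ty-resp-ntv e wf-top     = wf-top
⊢ty-resp-ntv e (wf-var p) = wf-var (≡-subst (_ <_) e p)
⊢ty-resp-ntv e (wf-⇒ a b) = wf-⇒ (⊢ty-resp-ntv e a) (⊢ty-resp-ntv e b)
⊢ty-resp-ntv e (wf-all a) = wf-all (⊢ty-resp-ntv (cong suc e) a)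
⊢ty-resp-ntv e (wf-∧ a b) = wf-∧ (⊢ty-resp-ntv e a) (⊢ty-resp-ntv e b)

⊢ty-rename : ∀ {Γ Δ ρ} → (∀ {n} → n < ntv Γ → ρ n < ntv Δ)
  → ∀ {A} → Γ ⊢ty A → Δ ⊢ty rename ρ A
⊢ty-rename h wf-top     = wf-top
⊢ty-rename h (wf-var p) = wf-var (h p)
⊢ty-rename h (wf-⇒ a b) = wf-⇒ (⊢ty-rename h a) (⊢ty-rename h b)
⊢ty-rename h (wf-all a) = wf-all (⊢ty-rename h' a)
  where
  h' : ∀ {n} → n < suc _ → ext _ n < suc _
  h' {zero}  _       = s≤s z≤n
  h' {suc n} (s≤s p) = s≤s (h p)
⊢ty-rename h (wf-∧ a b) = wf-∧ (⊢ty-rename h a) (⊢ty-rename h b)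

⊢ty-unrename : ∀ {Γ Δ ρ} → (∀ {n} → ρ n < ntv Δ → n < ntv Γ)
  → ∀ A → Δ ⊢ty rename ρ A → Γ ⊢ty A
⊢ty-unrename h ⊤'      _          = wf-top
⊢ty-unrename h (var n) (wf-var p) = wf-var (h p)
⊢ty-unrename h (A ⇒ B) (wf-⇒ a b) = wf-⇒ (⊢ty-unrename h A a) (⊢ty-unrename h B b)
⊢ty-unrename h (all A) (wf-all a) = wf-all (⊢ty-unrename h' A a)
  where
  h' : ∀ {n} → ext _ n < suc _ → n < suc _
  h' {zero}  _       = s≤s z≤n
  h' {suc n} (s≤s p) = s≤s (h p)
⊢ty-unrename h (A ∧ B) (wf-∧ a b) = wf-∧ (⊢ty-unrename h A a) (⊢ty-unrename h B b)

⊢ty-↑ : ∀ {Δ T A} → Δ ⊢ty A → (tv T ∷ Δ) ⊢ty ↑ A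
⊢ty-↑ = ⊢ty-rename s≤s

⊢ty-↑⁻¹ : ∀ {Δ T} A → (tv T ∷ Δ) ⊢ty ↑ A → Δ ⊢ty A
⊢ty-↑⁻¹ = ⊢ty-unrename s<s⁻¹

⊢ty-subst : ∀ {Γ Δ σ} → (∀ {n} → n < ntv Γ → Δ ⊢ty σ n)
  → ∀ {A} → Γ ⊢ty A → Δ ⊢ty subst σ A
⊢ty-subst h wf-top     = wf-top
⊢ty-subst h (wf-var p) = h p
⊢ty-subst h (wf-⇒ a b) = wf-⇒ (⊢ty-subst h a) (⊢ty-subst h b)
⊢ty-subst h (wf-all a) = wf-all (⊢ty-subst h' a)
  where
  h' : ∀ {n} → n < suc _ → _ ⊢ty exts _ n
  h' {zero}  _       = wf-var (s≤s z≤n)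
  h' {suc n} (s≤s p) = ⊢ty-↑ (h p)
⊢ty-subst h (wf-∧ a b) = wf-∧ (⊢ty-subst h a) (⊢ty-subst h b)

⊢ty-msubst-transfer : ∀ {Δ σ₋ σ₊ τ₋ τ₊}
  → (∀ n → Δ ⊢ty σ₋ n → Δ ⊢ty τ₋ n) → (∀ n → Δ ⊢ty σ₊ n → Δ ⊢ty τ₊ n)
  → ∀ A → Δ ⊢ty msubst σ₋ σ₊ A → Δ ⊢ty msubst τ₋ τ₊ A
⊢ty-msubst-transfer h₋ h₊ ⊤'      _          = wf-top
⊢ty-msubst-transfer h₋ h₊ (var n) a          = h₊ n a
⊢ty-msubst-transfer h₋ h₊ (A ⇒ B) (wf-⇒ a b) =
  wf-⇒ (⊢ty-msubst-transfer h₊ h₋ A a) (⊢ty-msubst-transfer h₋ h₊ B b)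
⊢ty-msubst-transfer h₋ h₊ (all A) (wf-all a) =
  wf-all (⊢ty-msubst-transfer (exts-transfer h₋) (exts-transfer h₊) A a)
  where
  exts-transfer : ∀ {σ τ} → (∀ n → _ ⊢ty σ n → _ ⊢ty τ n)
    → ∀ n → _ ⊢ty exts σ n → _ ⊢ty exts τ n
  exts-transfer h zero    a = a
  exts-transfer h (suc n) a = ⊢ty-↑ (h n (⊢ty-↑⁻¹ _ a))
⊢ty-msubst-transfer h₋ h₊ (A ∧ B) (wf-∧ a b) =
  wf-∧ (⊢ty-msubst-transfer h₋ h₊ A a) (⊢ty-msubst-transfer h₋ h₊ B b)

lookupTv-< : ∀ {Γ X T} → lookupTv Γ X ≡ just T → X < ntv Γ
lookupTv-< {[]} ()
lookupTv-< {tm _ ∷ Γ} eq = lookupTv-< {Γ} eq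
lookupTv-< {tv _ ∷ Γ} {zero} eq = s≤s z≤n
lookupTv-< {tv _ ∷ Γ} {suc X} eq with lookupTv Γ X in e
... | just _ = s≤s (lookupTv-< {Γ} e)
lookupTv-< {tv _ ∷ Γ} {suc X} () | nothing

lookupTv-⊢ty : ∀ {Γ} → ⊢ctx Γ → ∀ {X T} → lookupTv Γ X ≡ just T → Γ ⊢ty T
lookupTv-⊢ty wf-[] ()
lookupTv-⊢ty (wf-tm c _) eq = ⊢ty-resp-ntv refl (lookupTv-⊢ty c eq)
lookupTv-⊢ty (wf-tv c a) {zero} refl = ⊢ty-↑ a
lookupTv-⊢ty (wf-tv {Θ} c _) {suc X} eq with lookupTv Θ X in e
... | just _ with eq
...   | refl = ⊢ty-↑ (lookupTv-⊢ty c e)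
lookupTv-⊢ty (wf-tv {Θ} c _) {suc X} () | nothing

lookupTm-⊢ty : ∀ {Γ} → ⊢ctx Γ → ∀ {x T} → lookupTm Γ x ≡ just T → Γ ⊢ty T
lookupTm-⊢ty wf-[] ()
lookupTm-⊢ty (wf-tm c a) {zero} refl = ⊢ty-resp-ntv refl a
lookupTm-⊢ty (wf-tm c _) {suc x} eq = ⊢ty-resp-ntv refl (lookupTm-⊢ty c eq)
lookupTm-⊢ty (wf-tv {Θ} c _) {x} eq with lookupTm Θ x in e
... | just _ with eq
...   | refl = ⊢ty-↑ (lookupTm-⊢ty c e)
lookupTm-⊢ty (wf-tv {Θ} c _) {x} () | nothing

<:-regular : ∀ {Γ A B} → Γ ⊢ A <: B → ⊢ctx Γ × Γ ⊢ty A × Γ ⊢ty B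
<:-regular {Γ} (s-var c eq) = c , wf-var (lookupTv-< {Γ} eq) , lookupTv-⊢ty c eq
<:-regular (s-top c a)  = c , a , wf-top
<:-regular (s-refl c a) = c , a , a
<:-regular (s-trans p q) with <:-regular p | <:-regular q
... | c , a , _ | _ , _ , b = c , a , b
<:-regular (s-⇒ p q) with <:-regular p | <:-regular q
... | c , a , b | _ , a' , b' = c , wf-⇒ b a' , wf-⇒ a b'
<:-regular (s-all p) with <:-regular p
... | wf-tv c _ , a , b = c , wf-all a , wf-all b
<:-regular (s-∧l c (wf-∧ a b)) = c , wf-∧ a b , a
<:-regular (s-∧r c (wf-∧ a b)) = c , wf-∧ a b , b
<:-regular (s-∧ p q) with <:-regular p | <:-regular q
... | c , a , b | _ , _ , b' = c , a , wf-∧ b b'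

∶-regular : ∀ {Γ t A} → Γ ⊢ t ∶ A → ⊢ctx Γ × Γ ⊢ty A
∶-regular (t-top c)    = c , wf-top
∶-regular (t-var c eq) = c , lookupTm-⊢ty c eq
∶-regular (t-sub d s)  = proj₁ (∶-regular d) , proj₂ (proj₂ (<:-regular s))
∶-regular (t-lam d) with ∶-regular d
... | wf-tm c a , b = c , wf-⇒ a (⊢ty-resp-ntv refl b)
∶-regular (t-app d _) with ∶-regular d
... | c , wf-⇒ _ b = c , b
∶-regular (t-Lam d) with ∶-regular d
... | wf-tv c _ , b = c , wf-all b
∶-regular (t-tapp {S' = S'} d a) with ∶-regular d
... | c , wf-all b = c , ⊢ty-subst single-⊢ty b
  where
  single-⊢ty : ∀ {n} → n < suc _ → _ ⊢ty single S' n
  single-⊢ty {zero}  _       = a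
  single-⊢ty {suc n} (s≤s p) = wf-var p

extⁿ : ℕ → (ℕ → ℕ) → ℕ → ℕ
extⁿ zero    ρ = ρ
extⁿ (suc k) ρ = ext (extⁿ k ρ)

-- Γ' is Γ with a fresh variable X <: ⊤ inserted below its k innermost type variables.
data Insert : ℕ → Ctx → Ctx → Set where
  here   : ∀ {Γ} → Insert 0 Γ (tv ⊤' ∷ Γ)
  under-tv : ∀ {k Γ Γ' T} → Insert k Γ Γ' → Insert (suc k) (tv T ∷ Γ) (tv (rename (extⁿ k suc) T) ∷ Γ')
  under-tm : ∀ {k Γ Γ' T} → Insert k Γ Γ' → Insert k (tm T ∷ Γ) (tm (rename (extⁿ k suc) T) ∷ Γ')

Insert-< : ∀ {k Γ Γ'} → Insert k Γ Γ' → ∀ {n} → n < ntv Γ → extⁿ k suc n < ntv Γ'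
Insert-< here p = s≤s p
Insert-< (under-tv i) {zero}  _       = s≤s z≤n
Insert-< (under-tv i) {suc n} (s≤s p) = s≤s (Insert-< i p)
Insert-< (under-tm i) p = Insert-< i p

Insert-⊢ctx : ∀ {k Γ Γ'} → Insert k Γ Γ' → ⊢ctx Γ → ⊢ctx Γ'
Insert-⊢ctx here c = wf-tv c wf-top
Insert-⊢ctx (under-tv i) (wf-tv c a) = wf-tv (Insert-⊢ctx i c) (⊢ty-rename (Insert-< i) a)
Insert-⊢ctx (under-tm i) (wf-tm c a) = wf-tm (Insert-⊢ctx i c) (⊢ty-rename (Insert-< i) a)

Insert-lookupTv : ∀ {k Γ Γ'} → Insert k Γ Γ' → ∀ {X T} → lookupTv Γ X ≡ just T
  → lookupTv Γ' (extⁿ k suc X) ≡ just (rename (extⁿ k suc) T)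
Insert-lookupTv here eq rewrite eq = refl
Insert-lookupTv (under-tv {k} {T = U} i) {zero} refl = cong just (sym (rename-ext-↑ (extⁿ k suc) U))
Insert-lookupTv (under-tv {k} {Γ} i) {suc X} eq with lookupTv Γ X in e
... | just T with eq
...   | refl rewrite Insert-lookupTv i e = cong just (sym (rename-ext-↑ (extⁿ k suc) T))
Insert-lookupTv (under-tv {Γ = Γ} i) {suc X} () | nothing
Insert-lookupTv (under-tm i) eq = Insert-lookupTv i eq

<:-weaken : ∀ {k Γ Γ' A B} → Insert k Γ Γ' → Γ ⊢ A <: B
  → Γ' ⊢ rename (extⁿ k suc) A <: rename (extⁿ k suc) B
<:-weaken i (s-var c eq)  = s-var (Insert-⊢ctx i c) (Insert-lookupTv i eq)
<:-weaken i (s-top c a)   = s-top (Insert-⊢ctx i c) (⊢ty-rename (Insert-< i) a)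
<:-weaken i (s-refl c a)  = s-refl (Insert-⊢ctx i c) (⊢ty-rename (Insert-< i) a)
<:-weaken i (s-trans p q) = s-trans (<:-weaken i p) (<:-weaken i q)
<:-weaken i (s-⇒ p q)     = s-⇒ (<:-weaken i p) (<:-weaken i q)
<:-weaken i (s-all p)     = s-all (<:-weaken (under-tv i) p)
<:-weaken i (s-∧l c a)    = s-∧l (Insert-⊢ctx i c) (⊢ty-rename (Insert-< i) a)
<:-weaken i (s-∧r c a)    = s-∧r (Insert-⊢ctx i c) (⊢ty-rename (Insert-< i) a)
<:-weaken i (s-∧ p q)     = s-∧ (<:-weaken i p) (<:-weaken i q)

-- The pointwise hypotheses are asked only at well-formed instances, since
-- σ and τ may be junk at variables that are out of scope.
msubst-mono : ∀ {Γ σ₋ σ₊ τ₋ τ₊} → ⊢ctx Γ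
  → (∀ n → Γ ⊢ty τ₋ n → Γ ⊢ty σ₋ n → Γ ⊢ τ₋ n <: σ₋ n)
  → (∀ n → Γ ⊢ty σ₊ n → Γ ⊢ty τ₊ n → Γ ⊢ σ₊ n <: τ₊ n)
  → ∀ A → Γ ⊢ty msubst σ₋ σ₊ A → Γ ⊢ty msubst τ₋ τ₊ A
  → Γ ⊢ msubst σ₋ σ₊ A <: msubst τ₋ τ₊ A
msubst-mono c h₋ h₊ ⊤'      _ _ = s-top c wf-top
msubst-mono c h₋ h₊ (var n) a b = h₊ n a b
msubst-mono c h₋ h₊ (A ⇒ B) (wf-⇒ a b) (wf-⇒ a' b') =
  s-⇒ (msubst-mono c h₊ h₋ A a' a)
      (msubst-mono c h₋ h₊ B b b')
msubst-mono {Γ} c h₋ h₊ (all A) (wf-all a) (wf-all a') =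
  s-all (msubst-mono (wf-tv c wf-top) (exts-<: h₋) (exts-<: h₊) A a a')
  where
  exts-<: : ∀ {σ τ} → (∀ n → Γ ⊢ty σ n → Γ ⊢ty τ n → Γ ⊢ σ n <: τ n)
    → ∀ n → (tv ⊤' ∷ Γ) ⊢ty exts σ n → (tv ⊤' ∷ Γ) ⊢ty exts τ n
    → (tv ⊤' ∷ Γ) ⊢ exts σ n <: exts τ n
  exts-<: h zero    x _ = s-refl (wf-tv c wf-top) x
  exts-<: h (suc n) x y = <:-weaken here (h n (⊢ty-↑⁻¹ _ x) (⊢ty-↑⁻¹ _ y))
msubst-mono c h₋ h₊ (A ∧ B) (wf-∧ a b) (wf-∧ a' b') =
  s-∧ (s-trans (s-∧l c (wf-∧ a b)) (msubst-mono c h₋ h₊ A a a'))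
      (s-trans (s-∧r c (wf-∧ a b)) (msubst-mono c h₋ h₊ B b b'))

msubst-single-mono : ∀ {Γ U U' V V'} T → Γ ⊢ U' <: U → Γ ⊢ V <: V'
  → Γ ⊢ty msubst (single U) (single V) T
  → Γ ⊢ msubst (single U) (single V) T <: msubst (single U') (single V') T
msubst-single-mono {Γ} T U'<:U V<:V' ⊢T =
  msubst-mono ⊢Γ (single-<: U'<:U) (single-<: V<:V') T ⊢T
    (⊢ty-msubst-transfer (single-⊢ty (proj₁ (proj₂ (<:-regular U'<:U))))
                         (single-⊢ty (proj₂ (proj₂ (<:-regular V<:V')))) T ⊢T)
  where
  ⊢Γ : ⊢ctx Γ
  ⊢Γ = proj₁ (<:-regular U'<:U)
  single-⊢ty : ∀ {W W'} → Γ ⊢ty W' → ∀ n → Γ ⊢ty single W n → Γ ⊢ty single W' n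
  single-⊢ty ⊢W' zero    _  = ⊢W'
  single-⊢ty ⊢W' (suc n) ⊢X = ⊢X
  single-<: : ∀ {W W'} → Γ ⊢ W <: W'
    → ∀ n → Γ ⊢ty single W n → Γ ⊢ty single W' n → Γ ⊢ single W n <: single W' n
  single-<: W<:W' zero    _  _ = W<:W'
  single-<: W<:W' (suc n) ⊢X _ = s-refl ⊢Γ ⊢X

retype : ∀ {Θ t A B} → A ≡ B → Θ ⊢ t ∶ A → Θ ⊢ t ∶ B
retype {Θ} {t} = ≡-subst (Θ ⊢ t ∶_)

mainTheorem20 : ∀ {Θ t T S S'}
    → Θ ⊢ t ∶ all (T [ var 0 ∧ ↑ S /0⁻])
    → Θ ⊢ S' <: S
    → Θ ⊢ tapp t S' ∶ T [ S' ]
mainTheorem20 {Θ} {t} {T} {S} {S'} ⊢t S'<:S =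
  retype (msubst-diagonal (single S') T)
    (t-sub ⊢tS' (msubst-single-mono T S'<:S'∧S S'<:S' (proj₂ (∶-regular ⊢tS'))))
  where
  S'<:S' : Θ ⊢ S' <: S'
  S'<:S' = s-refl (proj₁ (<:-regular S'<:S)) (proj₁ (proj₂ (<:-regular S'<:S)))
  S'<:S'∧S : Θ ⊢ S' <: S' ∧ S
  S'<:S'∧S = s-∧ S'<:S' S'<:S
  ⊢tS' : Θ ⊢ tapp t S' ∶ msubst (single (S' ∧ S)) (single S') T
  ⊢tS' = retype ([∧/0⁻]-[] T S S') (t-tapp ⊢t (proj₁ (proj₂ (<:-regular S'<:S))))
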